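{- Let $l\in[0,2n]$ and let $\mathbf a=(a_1<\dots<a_l)$ be a column with entries in $\{1,\dots,2n\}$. Then $\mathrm{rem}(\mathbf a)=\mathbf a$ (i.e. every entry of $\mathbf a$ lies in $\mathrm{rem}(\mathbf a)$) if and only if $l$ is even and $\mathbf a=(1,2,\dots,l)$.
   Context: The removal subword of a column $\mathbf a=(a_1<\dots<a_l)$ is defined recursively: $\mathrm{rem}(\mathbf a)=\emptyset$ if $l\le1$; if $l\ge2$, $a_l$ is even, $a_{l-1}=a_l-1$ and $a_l<2l-|\mathrm{rem}(a_1,\dots,a_{l-2})|-1$, then $\mathrm{rem}(\mathbf a)=\mathrm{rem}(a_1,\dots,a_{l-2})\,(a_{l-1},a_l)$; otherwise $\mathrm{rem}(\mathbf a)=\mathrm{rem}(a_1,\dots,a_{l-1})$. The empty column ($l=0$) has $\mathrm{rem}=\emptyset$. -}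

module Defs where

open import Data.Nat using (ℕ; zero; suc; _+_; _*_; _∸_; _<_; _<?_; _≟_)
open import Data.Nat.Divisibility using (_∣_; _∣?_)
open import Data.List using (List; []; _∷_; length; reverse; applyUpTo)
open import Data.Product using (_×_)
open import Relation.Nullary using (Dec; does)
open import Relation.Nullary.Decidable using (_×-dec_)
open import Relation.Binary.PropositionalEquality using (_≡_)
open import Data.Bool using (if_then_else_)

-- Removal subword computed on the REVERSED column:
-- input  (a_l ∷ a_{l-1} ∷ ... ∷ a_1), output the reversed rem.
-- For x = a_l, y = a_{l-1}, r = (a_{l-2},...,a_1) reversed, l = length r + 2:
-- the pair is kept iff  a_l even, a_{l-1} = a_l - 1, a_l < 2l - |rem(a_1..a_{l-2})| - 1.
remRev : List ℕ → List ℕ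
remRev []           = []
remRev (x ∷ [])     = []
remRev (x ∷ y ∷ r) =
  if does ((2 ∣? x) ×-dec ((x ≟ suc y) ×-dec (x <? (2 * (length r + 2) ∸ length (remRev r) ∸ 1))))
  then x ∷ y ∷ remRev r
  else remRev (y ∷ r)

rem : List ℕ → List ℕ
rem a = reverse (remRev (reverse a))

oneTo : ℕ → List ℕ
oneTo l = applyUpTo suc l

-- Work with the column read backwards, d = (a_l, …, a_1). The removal subword is never longer
-- than its input, so if it equals d then the top pair is kept and the rest r is again a fixed
-- point; by induction r = (2k, …, 2, 1), on which the keeping bound is exactly 2k + 3. The top
-- pair (x, x − 1) lies above 2k, x is even and x < 2k + 3, hence it is (2k + 2, 2k + 1).
-- The same bound shows that (2k, …, 1) keeps every pair, which gives the converse.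
module Submission where

open import Defs
open import Data.Nat using (ℕ; zero; suc; _+_; _*_; _∸_; _≤_; _<_; _>_; _≟_; _<?_; z≤n; s≤s)
open import Data.Nat.Properties
  using ( ≤-refl; <⇒≤; ≤-antisym; ≤-pred; <⇒≱; m≤n⇒m≤1+n; m≤n⇒m<n∨m≡n; m+n∸n≡m
        ; *-comm; even≢odd)
open import Data.Nat.Divisibility using (_∣_; _∣?_; divides)
open import Data.List using (List; []; _∷_; length; reverse; reverseAcc; applyDownFrom)
open import Data.List.Properties
  using ( ∷-injectiveʳ; length-applyDownFrom; length-reverse
        ; reverse-involutive; reverse-applyUpTo; reverse-applyDownFrom)
open import Data.List.Relation.Unary.All using (All)
open import Data.List.Relation.Unary.Linked as Linked using (Linked; []; [-]; _∷_)
open import Data.Nat.Tactic.RingSolver using (solve-∀)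
open import Data.Product using (_×_; _,_; ∃)
open import Data.Product.Function.NonDependent.Propositional using (_×-⇔_)
open import Data.Sum using (_⊎_; inj₁; inj₂)
open import Data.Bool using (if_then_else_)
open import Data.Empty using (⊥-elim)
open import Function using (flip)
open import Function.Bundles using (_⇔_; mk⇔)
import Function.Properties.Equivalence as ⇔
open import Relation.Binary.Core using (Rel)
open import Relation.Nullary using (Dec; does; yes; no; ¬_)
open import Relation.Nullary.Decidable using (_×-dec_)
open import Relation.Binary.PropositionalEquality
  using (_≡_; refl; sym; trans; cong; subst; module ≡-Reasoning)

module _ {a ℓ} {A : Set a} {R : Rel A ℓ} where

  private
    reverseAcc-Linked : ∀ {x acc xs} → Linked (flip R) (x ∷ acc) → Linked R (x ∷ xs) →
                        Linked (flip R) (reverseAcc (x ∷ acc) xs)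
    reverseAcc-Linked q [-]       = q
    reverseAcc-Linked q (Rxy ∷ p) = reverseAcc-Linked (Rxy ∷ q) p

  Linked-reverse : ∀ {xs} → Linked R xs → Linked (flip R) (reverse xs)
  Linked-reverse {[]}    []  = []
  Linked-reverse {_ ∷ _} p   = reverseAcc-Linked [-] p

pairBound : List ℕ → ℕ
pairBound r = 2 * (length r + 2) ∸ length (remRev r) ∸ 1

KeepsPair : ℕ → ℕ → List ℕ → Set
KeepsPair x y r = 2 ∣ x × x ≡ suc y × x < pairBound r

keepsPair? : ∀ x y r → Dec (KeepsPair x y r)
keepsPair? x y r = (2 ∣? x) ×-dec ((x ≟ suc y) ×-dec (x <? pairBound r))

ifDec : ∀ {p} {Q : Set p} {A : Set} (d : Dec Q) {t e : A} →
  (Q × (if does d then t else e) ≡ t) ⊎ (¬ Q × (if does d then t else e) ≡ e)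
ifDec (yes q) = inj₁ (q , refl)
ifDec (no ¬q) = inj₂ (¬q , refl)

remRev-∷∷ : ∀ x y r →
  (KeepsPair x y r × remRev (x ∷ y ∷ r) ≡ x ∷ y ∷ remRev r) ⊎
  (¬ KeepsPair x y r × remRev (x ∷ y ∷ r) ≡ remRev (y ∷ r))
remRev-∷∷ x y r = ifDec (keepsPair? x y r)

length-remRev-∷∷≤ : ∀ x y r →
  length (remRev r) ≤ length r → length (remRev (y ∷ r)) ≤ length (y ∷ r) →
  length (remRev (x ∷ y ∷ r)) ≤ length (x ∷ y ∷ r)
length-remRev-∷∷≤ x y r ih₂ ih₁ with remRev-∷∷ x y r
... | inj₁ (_ , eq) rewrite eq = s≤s (s≤s ih₂)
... | inj₂ (_ , eq) rewrite eq = m≤n⇒m≤1+n ih₁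

length-remRev≤ : ∀ d → length (remRev d) ≤ length d
length-remRev≤ []          = z≤n
length-remRev≤ (x ∷ [])    = z≤n
length-remRev≤ (x ∷ y ∷ r) = length-remRev-∷∷≤ x y r (length-remRev≤ r) (length-remRev≤ (y ∷ r))

remRev-fixed-∷∷ : ∀ {x y r} → remRev (x ∷ y ∷ r) ≡ x ∷ y ∷ r → KeepsPair x y r × remRev r ≡ r
remRev-fixed-∷∷ {x} {y} {r} fixed with remRev-∷∷ x y r
... | inj₁ (k , eq) = k , ∷-injectiveʳ (∷-injectiveʳ (trans (sym eq) fixed))
... | inj₂ (_ , eq) = ⊥-elim (<⇒≱ ≤-refl (subst (λ d → length d ≤ length (y ∷ r))
                                                 (trans (sym eq) fixed) (length-remRev≤ (y ∷ r))))

remRev-keep : ∀ {x y r} → KeepsPair x y r → remRev (x ∷ y ∷ r) ≡ x ∷ y ∷ remRev r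
remRev-keep {x} {y} {r} k with remRev-∷∷ x y r
... | inj₁ (_ , eq)  = eq
... | inj₂ (¬k , _) = ⊥-elim (¬k k)

pairBound-fixed : ∀ {r} → remRev r ≡ r → pairBound r ≡ 3 + length r
pairBound-fixed {r} fixed = begin
  2 * (m + 2) ∸ length (remRev r) ∸ 1  ≡⟨ cong (λ d → 2 * (m + 2) ∸ length d ∸ 1) fixed ⟩
  2 * (m + 2) ∸ m ∸ 1                  ≡⟨ cong (λ n → n ∸ m ∸ 1) (expand m) ⟩
  4 + m + m ∸ m ∸ 1                    ≡⟨ cong (_∸ 1) (m+n∸n≡m (4 + m) m) ⟩
  3 + m                                ∎
  where
  open ≡-Reasoning
  m = length r
  expand : ∀ n → 2 * (n + 2) ≡ 4 + n + n
  expand = solve-∀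

oneToRev : ℕ → List ℕ
oneToRev l = applyDownFrom suc l

pairBound-oneToRev : ∀ {m} → remRev (oneToRev m) ≡ oneToRev m → pairBound (oneToRev m) ≡ 3 + m
pairBound-oneToRev {m} fixed =
  trans (pairBound-fixed fixed) (cong (3 +_) (length-applyDownFrom suc m))

remRev-oneToRev-even : ∀ k → remRev (oneToRev (k * 2)) ≡ oneToRev (k * 2)
remRev-oneToRev-even zero    = refl
remRev-oneToRev-even (suc k) =
  trans (remRev-keep {r = oneToRev (k * 2)} (divides (suc k) refl , refl , bound))
        (cong (λ d → 2 + k * 2 ∷ 1 + k * 2 ∷ d) ih)
  where
  ih : remRev (oneToRev (k * 2)) ≡ oneToRev (k * 2)
  ih = remRev-oneToRev-even k
  bound : 2 + k * 2 < pairBound (oneToRev (k * 2))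
  bound = subst (2 + k * 2 <_) (sym (pairBound-oneToRev ih)) ≤-refl

odd-∤2 : ∀ k → ¬ 2 ∣ suc (k * 2)
odd-∤2 k (divides q eq) = even≢odd q k (trans (*-comm 2 q) (trans (sym eq) (cong suc (*-comm k 2))))

oneToRev-≤-head : ∀ {y m} → Linked _>_ (y ∷ oneToRev m) → m ≤ y
oneToRev-≤-head {m = zero}  _         = z≤n
oneToRev-≤-head {m = suc _} (y>m ∷ _) = <⇒≤ y>m

keepsPair-oneToRev-even : ∀ {y} k → Linked _>_ (y ∷ oneToRev (k * 2)) →
  KeepsPair (suc y) y (oneToRev (k * 2)) → y ≡ suc (k * 2)
keepsPair-oneToRev-even {y} k ordered (even , _ , bound)
  with m≤n⇒m<n∨m≡n (oneToRev-≤-head ordered)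
... | inj₁ k*2<y = ≤-antisym (≤-pred (≤-pred bound′)) k*2<y
  where
  bound′ : suc y < 3 + k * 2
  bound′ = subst (suc y <_) (pairBound-oneToRev (remRev-oneToRev-even k)) bound
... | inj₂ refl = ⊥-elim (odd-∤2 k even)

remRev-fixed⇒oneToRev-even : ∀ {d} → Linked _>_ d → remRev d ≡ d → ∃ λ k → d ≡ oneToRev (k * 2)
remRev-fixed⇒oneToRev-even []  _ = zero , refl
remRev-fixed⇒oneToRev-even [-] ()
remRev-fixed⇒oneToRev-even {x ∷ y ∷ r} (_ ∷ ordered) fixed
  with remRev-fixed-∷∷ fixed
... | keeps@(_ , refl , _) , r-fixed
  with remRev-fixed⇒oneToRev-even (Linked.tail ordered) r-fixed
... | k , refl =
  suc k , cong (λ z → suc z ∷ z ∷ oneToRev (k * 2)) (keepsPair-oneToRev-even k ordered keeps)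

remRev-fixed⇔ : ∀ {d} → Linked _>_ d → remRev d ≡ d ⇔ (2 ∣ length d × d ≡ oneToRev (length d))
remRev-fixed⇔ {d} decreasing = mk⇔ to from
  where
  to : remRev d ≡ d → 2 ∣ length d × d ≡ oneToRev (length d)
  to fixed with remRev-fixed⇒oneToRev-even decreasing fixed
  ... | k , refl = divides k length≡ , cong oneToRev (sym length≡)
    where length≡ = length-applyDownFrom suc (k * 2)
  from : 2 ∣ length d × d ≡ oneToRev (length d) → remRev d ≡ d
  from (divides k length≡ , d≡) =
    subst (λ c → remRev c ≡ c) (sym (trans d≡ (cong oneToRev length≡))) (remRev-oneToRev-even k)

rem-fixed⇔ : ∀ a → rem a ≡ a ⇔ remRev (reverse a) ≡ reverse a
rem-fixed⇔ a = mk⇔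
  (λ fixed → trans (sym (reverse-involutive _)) (cong reverse fixed))
  (λ fixed → trans (cong reverse fixed) (reverse-involutive a))

reverse≡oneToRev⇔ : ∀ a l → reverse a ≡ oneToRev l ⇔ a ≡ oneTo l
reverse≡oneToRev⇔ a l = mk⇔
  (λ eq → trans (sym (reverse-involutive a))
                 (trans (cong reverse eq) (reverse-applyDownFrom suc l)))
  (λ eq → trans (cong reverse eq) (reverse-applyUpTo suc l))

-- The bounds on the entries and on the length are not needed: a strictly increasing
-- column of naturals suffices.
mainTheorem6 : (n : ℕ) (a : List ℕ) →
    Linked _<_ a →
    All (λ x → 1 ≤ x × x ≤ 2 * n) a →
    length a ≤ 2 * n →
    (rem a ≡ a) ⇔ (2 ∣ length a × a ≡ oneTo (length a))
mainTheorem6 n a increasing _ _ =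
  ⇔.trans (rem-fixed⇔ a) (⇔.trans (remRev-fixed⇔ (Linked-reverse increasing)) unreverse)
  where
  unreverse : (2 ∣ length (reverse a) × reverse a ≡ oneToRev (length (reverse a)))
            ⇔ (2 ∣ length a × a ≡ oneTo (length a))
  unreverse rewrite length-reverse a = ⇔.refl ×-⇔ reverse≡oneToRev⇔ a (length a)
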